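{- Let $G$ be a graph of maximum degree at most 3 that contains $K_{2,3}$ as a subgraph. Then for all vertex weights $a^*,d^*:V(G)\to\{0,1\}$, $(G,a^*,d^*)$ is a NO-instance of $(1,1)$-Cluster Editing.
   Context: $(G,a^*,d^*)$ is a YES-instance of $(1,1)$-Cluster Editing if there is a matching $D$ of edges $uv$ of $G$ with $d^*(u)=d^*(v)=1$ and a matching $A$ of non-edges $uv$ of $G$ with $a^*(u)=a^*(v)=1$ such that $G-D+A$ is a vertex-disjoint union of cliques; otherwise it is a NO-instance. $K_{2,3}$ is the complete bipartite graph with parts of sizes 2 and 3. -}

module Defs where

open import Data.Nat using (ℕ; _≤_)
open import Data.Fin using (Fin; zero; suc)
open import Data.Bool using (Bool; true; false)
open import Data.List using (List; length; filter)
open import Data.List using () renaming (map to lmap)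
open import Data.Fin.Base using ()
open import Data.List.Base using ()
open import Data.Vec.Functional using ()
open import Data.Product using (Σ; _×_; _,_)
open import Data.Empty using (⊥)
open import Relation.Nullary using (¬_)
open import Relation.Binary.PropositionalEquality using (_≡_; _≢_)
open import Data.Bool.Properties using (T?)
open import Data.Bool using (T)
open import Function.Definitions using (Injective)
import Data.List as L
import Data.Fin as F

record Graph (n : ℕ) : Set where
  field
    adj    : Fin n → Fin n → Bool
    sym    : ∀ u v → adj u v ≡ adj v u
    irrefl : ∀ v → adj v v ≡ false
open Graph public

degree : ∀ {n} → Graph n → Fin n → ℕ
degree {n} G v = length (filter (λ u → T? (adj G v u)) (L.allFin n))

MaxDegreeAtMost : ∀ {n} → Graph n → ℕ → Set
MaxDegreeAtMost G k = ∀ v → degree G v ≤ k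

-- Vertices 0,1 of Fin 5 form the part of size 2, vertices 2,3,4 the part of size 3.
SmallSide : Fin 5 → Set
SmallSide zero = Data.Unit.⊤ where import Data.Unit
SmallSide (suc zero) = Data.Unit.⊤ where import Data.Unit
SmallSide (suc (suc _)) = ⊥

ContainsK23 : ∀ {n} → Graph n → Set
ContainsK23 {n} G =
  Σ (Fin 5 → Fin n) λ f →
    Injective _≡_ _≡_ f ×
    (∀ i j → SmallSide i → ¬ SmallSide j → T (adj G (f i) (f j)))

record Matching (n : ℕ) : Set where
  field
    rel     : Fin n → Fin n → Bool
    rsym    : ∀ u v → rel u v ≡ rel v u
    rirrefl : ∀ v → rel v v ≡ false
    unique  : ∀ u v w → T (rel u v) → T (rel u w) → v ≡ w
open Matching public

edited : ∀ {n} → Graph n → Matching n → Matching n → Fin n → Fin n → Set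
edited G D A u v = (T (adj G u v) × ¬ T (rel D u v)) Data.Sum.⊎ T (rel A u v)
  where import Data.Sum

-- A graph given by an adjacency predicate E is a vertex-disjoint union of
-- cliques iff adjacency is transitive on distinct vertices (P3-free).
IsClusterGraph : ∀ {n} → (Fin n → Fin n → Set) → Set
IsClusterGraph {n} E = ∀ u v w → E u v → E v w → u ≢ w → E u w

YesInstance11 : ∀ {n} → Graph n → (Fin n → Fin 2) → (Fin n → Fin 2) → Set
YesInstance11 {n} G a* d* =
  Σ (Matching n) λ D → Σ (Matching n) λ A →
    (∀ u v → T (rel D u v) → T (adj G u v) × d* u ≡ F.suc F.zero × d* v ≡ F.suc F.zero) ×
    (∀ u v → T (rel A u v) → ¬ T (adj G u v) × a* u ≡ F.suc F.zero × a* v ≡ F.suc F.zero) ×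
    IsClusterGraph (edited G D A)

{-# OPTIONS --safe #-}
-- Let x₁, x₂ be the small and y₁, y₂, y₃ the large side of the K₂,₃ and let
-- E = G − D + A be a cluster graph. As D is a matching, some yⱼ keeps both of its
-- edges to x₁ and x₂, so x₁x₂ ∈ E by transitivity. Then D deletes at most one of
-- x₁yⱼ, x₂yⱼ, so x₁yⱼ ∈ E for every j, and hence E contains the triangle y₁y₂y₃.
-- The matching A supplies at most one side of that triangle, so some yⱼ is
-- G-adjacent to the two other y's besides x₁ and x₂: degree 4.
module Submission where

open import Defs
open import Data.Nat using (ℕ; _≤_)
open import Data.Nat.Properties using (≤-trans; <-irrefl)
open import Data.Fin using (Fin; zero; suc; punchIn)
open import Data.Fin.Properties using (injective⇒≤; punchIn-injective; suc-injective)
open import Data.Bool using (T)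
open import Data.Bool.Properties using (T?)
open import Data.Unit using (tt)
open import Data.Empty using (⊥)
open import Data.Sum using (_⊎_; inj₁; inj₂)
open import Data.Product using (∃; _×_; _,_; map₂; swap)
open import Data.List using (List; filter; allFin; lookup)
open import Data.List.Membership.Propositional using (_∈_)
open import Data.List.Membership.Propositional.Properties using (∈-filter⁺; ∈-allFin)
open import Data.List.Relation.Unary.Any using (index)
open import Data.List.Relation.Unary.Any.Properties using (lookup-index)
open import Function using (_∘_; case_of_)
open import Function.Definitions using (Injective)
open import Relation.Nullary using (¬_; yes; no)
open import Relation.Binary.PropositionalEquality
  using (_≡_; _≢_; refl; cong; subst; module ≡-Reasoning)

module _ {n : ℕ} (G : Graph n) where

  adj-sym : ∀ {u v} → T (adj G u v) → T (adj G v u)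
  adj-sym {u} {v} = subst T (Graph.sym G u v)

  injective⇒≤degree : ∀ {k} v (g : Fin k → Fin n) → Injective _≡_ _≡_ g →
                      (∀ i → T (adj G v (g i))) → k ≤ degree G v
  injective⇒≤degree {k} v g g-inj g-adj = injective⇒≤ position-inj
    where
    open ≡-Reasoning
    neighbours : List (Fin n)
    neighbours = filter (λ u → T? (adj G v u)) (allFin n)

    g∈neighbours : ∀ i → g i ∈ neighbours
    g∈neighbours i = ∈-filter⁺ (λ u → T? (adj G v u)) (∈-allFin (g i)) (g-adj i)

    position : Fin k → Fin (degree G v)
    position i = index (g∈neighbours i)

    position-inj : Injective _≡_ _≡_ position
    position-inj {i} {j} eq = g-inj (begin
      g i                            ≡⟨ lookup-index (g∈neighbours i) ⟩
      lookup neighbours (position i) ≡⟨ cong (lookup neighbours) eq ⟩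
      lookup neighbours (position j) ≡⟨ lookup-index (g∈neighbours j) ⟨
      g j                            ∎)

module _ {n : ℕ} (M : Matching n) where

  rel-sym : ∀ {u v} → T (rel M u v) → T (rel M v u)
  rel-sym {u} {v} = subst T (rsym M u v)

  module _ {w : Fin 3 → Fin n} (w-inj : Injective _≡_ _≡_ w) where

    one-partner-among : ∀ {u i j} → T (rel M u (w i)) → T (rel M u (w j)) → i ≡ j
    one-partner-among p q = w-inj (unique M _ _ _ p q)

    unmatched-besides-partner : ∀ {u v} → T (rel M u (w zero)) →
                                ∃ λ j → ¬ T (rel M u (w j)) × ¬ T (rel M v (w j))
    unmatched-besides-partner {v = v} u0 with T? (rel M v (w (suc zero)))
    ... | no ¬v1 = suc zero , (λ u1 → case one-partner-among u0 u1 of λ ()) , ¬v1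
    ... | yes v1 = suc (suc zero) , (λ u2 → case one-partner-among u0 u2 of λ ())
                                  , (λ v2 → case one-partner-among v1 v2 of λ ())

    unmatched-by-both : ∀ u v → ∃ λ j → ¬ T (rel M u (w j)) × ¬ T (rel M v (w j))
    unmatched-by-both u v with T? (rel M u (w zero)) | T? (rel M v (w zero))
    ... | no ¬u0 | no ¬v0 = zero , ¬u0 , ¬v0
    ... | yes u0 | _      = unmatched-besides-partner u0
    ... | no _   | yes v0 = map₂ swap (unmatched-besides-partner v0)

    triangle-apex : (G : Graph n) →
                    (∀ j k → j ≢ k → T (adj G (w j) (w k)) ⊎ T (rel M (w j) (w k))) →
                    ∃ λ j → ∀ k → T (adj G (w j) (w (punchIn j k)))
    triangle-apex G side
      with side zero (suc zero) (λ ()) | side zero (suc (suc zero)) (λ ())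
         | side (suc zero) (suc (suc zero)) (λ ())
    ... | inj₁ p | inj₁ q | _      = zero , λ { zero → p ; (suc zero) → q }
    ... | inj₁ p | inj₂ _ | inj₁ r = suc zero , λ { zero → adj-sym G p ; (suc zero) → r }
    ... | inj₂ _ | inj₁ q | inj₁ r = suc (suc zero) , λ { zero → adj-sym G q ; (suc zero) → adj-sym G r }
    ... | inj₂ p | inj₂ q | _      = case one-partner-among p q of λ ()
    ... | inj₂ p | _      | inj₂ r = case one-partner-among (rel-sym p) r of λ ()
    ... | _      | inj₂ q | inj₂ r = case one-partner-among (rel-sym q) (rel-sym r) of λ ()

module Edited {n : ℕ} (G : Graph n) (D A : Matching n) where

  edited-sym : ∀ {u v} → edited G D A u v → edited G D A v u
  edited-sym (inj₁ (uv , ¬D)) = inj₁ (adj-sym G uv , ¬D ∘ rel-sym D)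
  edited-sym (inj₂ uv)        = inj₂ (rel-sym A uv)

  edited⇒adj⊎added : ∀ {u v} → edited G D A u v → T (adj G u v) ⊎ T (rel A u v)
  edited⇒adj⊎added (inj₁ (uv , _)) = inj₁ uv
  edited⇒adj⊎added (inj₂ uv)       = inj₂ uv

  edited-common-neighbour : IsClusterGraph (edited G D A) → ∀ {u v w} →
                            edited G D A u v → u ≢ v → u ≢ w →
                            T (adj G u w) → T (adj G v w) → edited G D A u w
  edited-common-neighbour cluster {u} {v} {w} uv u≢v u≢w uw vw with T? (rel D u w)
  ... | no ¬D = inj₁ (uw , ¬D)
  ... | yes D-uw = cluster u v w uv (inj₁ (vw , λ D-vw →
                     u≢v (unique D w u v (rel-sym D D-uw) (rel-sym D D-vw)))) u≢w

module _ {n : ℕ} (G : Graph n) (maxdeg : MaxDegreeAtMost G 3)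
         (D A : Matching n) (cluster : IsClusterGraph (edited G D A))
         (f : Fin 5 → Fin n) (f-inj : Injective _≡_ _≡_ f)
         (f-adj : ∀ i j → SmallSide i → ¬ SmallSide j → T (adj G (f i) (f j))) where

  open Edited G D A

  private
    x₁ x₂ : Fin n
    x₁ = f zero
    x₂ = f (suc zero)

    y : Fin 3 → Fin n
    y j = f (suc (suc j))

    y-inj : Injective _≡_ _≡_ y
    y-inj = suc-injective ∘ suc-injective ∘ f-inj

    f-distinct : ∀ {i j} → i ≢ j → f i ≢ f j
    f-distinct i≢j = i≢j ∘ f-inj

    x₁-y : ∀ j → T (adj G x₁ (y j))
    x₁-y j = f-adj zero (suc (suc j)) tt λ ()

    x₂-y : ∀ j → T (adj G x₂ (y j))
    x₂-y j = f-adj (suc zero) (suc (suc j)) tt λ ()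

    overfull : ∀ i → ¬ (∀ j → T (adj G (f i) (f (punchIn i j))))
    overfull i adj-rest = <-irrefl refl (≤-trans
      (injective⇒≤degree G (f i) (f ∘ punchIn i) (punchIn-injective i _ _ ∘ f-inj) adj-rest)
      (maxdeg (f i)))

    x₁x₂-edited : edited G D A x₁ x₂
    x₁x₂-edited with unmatched-by-both D y-inj x₁ x₂
    ... | j , ¬D₁ , ¬D₂ = cluster x₁ (y j) x₂ (inj₁ (x₁-y j , ¬D₁))
                            (edited-sym (inj₁ (x₂-y j , ¬D₂))) (f-distinct λ ())

    x₁y-edited : ∀ j → edited G D A x₁ (y j)
    x₁y-edited j = edited-common-neighbour cluster x₁x₂-edited
                     (f-distinct λ ()) (f-distinct λ ()) (x₁-y j) (x₂-y j)

    yy-edited : ∀ j k → j ≢ k → edited G D A (y j) (y k)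
    yy-edited j k j≢k =
      cluster (y j) x₁ (y k) (edited-sym (x₁y-edited j)) (x₁y-edited k) (j≢k ∘ y-inj)

  K₂,₃-not-editable : ⊥
  K₂,₃-not-editable
    with triangle-apex A y-inj G (λ j k j≢k → edited⇒adj⊎added (yy-edited j k j≢k))
  ... | j , apex = overfull (suc (suc j)) λ where
    zero          → adj-sym G (x₁-y j)
    (suc zero)    → adj-sym G (x₂-y j)
    (suc (suc k)) → apex k

lemma12 : ∀ {n} (G : Graph n) → MaxDegreeAtMost G 3 → ContainsK23 G →
    (a* d* : Fin n → Fin 2) → ¬ YesInstance11 G a* d*
lemma12 G maxdeg (f , f-inj , f-adj) _ _ (D , A , _ , _ , cluster) =
  K₂,₃-not-editable G maxdeg D A cluster f f-inj f-adj
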